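{- Let $X$ be a finite set and let $u\in\mathcal{U}^X$. Then $u$ is cyclic if and only if $u_Z$ is cyclic (as a vector in $\mathrm{GF}(2)^{Z^3}$) for every $4$-element subset $Z\subseteq X$.
   Context: A cyclic ordering of a finite set $X$ is an equivalence class $[x_1,\dots,x_n]$ of linear orderings of $X$ modulo rotation; $C\succeq[y_1,\dots,y_k]$ means $[y_1,\dots,y_k]$ arises from $C$ by omitting entries. For a cyclic ordering $C$ of a finite set $Y$, $u^C\in\mathrm{GF}(2)^{Y^3}$ has $u^C(x,y,z)=1$ iff $x,y,z$ are distinct and $C\succeq[x,y,z]$. A vector $u\in\mathrm{GF}(2)^{Y^3}$ is cyclic if $u=u^C$ for some cyclic ordering $C$ of $Y$. For $u\in\mathrm{GF}(2)^{X^3}$ and $Z\subseteq X$, $u_Z\in\mathrm{GF}(2)^{Z^3}$ is the restriction of $u$ to the entries indexed by $Z^3$. $\mathcal{U}^X$ is the affine subspace of all $u\in\mathrm{GF}(2)^{X^3}$ such that: $u(x,x,y)=0$ for all $x,y$; $u(x,y,z)+u(y,z,x)=0$ for all $x,y,z$; $u(x,y,z)+u(y,x,z)=1$ for all pairwise distinct $x,y,z$; and $u(t,x,y)+u(t,x,z)+u(t,y,z)+u(x,y,z)=0$ for all pairwise distinct $t,x,y,z$. -}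

module Defs where

open import Data.Nat using (ℕ)
open import Data.Bool using (Bool; true; false; _xor_)
open import Data.Fin using (Fin)
open import Data.Fin.Subset using (Subset)
import Data.Fin.Subset as S
open import Data.List using (List; []; _∷_; _++_)
open import Data.List.Membership.Propositional using (_∈_)
open import Data.List.Relation.Unary.Unique.Propositional using (Unique)
open import Data.List.Relation.Binary.Sublist.Propositional using (_⊆_)
open import Data.Product using (Σ; _×_; ∃; ∃-syntax)
open import Function.Bundles using (_⇔_)
open import Relation.Binary.PropositionalEquality using (_≡_; _≢_)

-- GF(2) is modelled by Bool, with addition _xor_ (0 = false, 1 = true).
-- A vector in GF(2)^{X^3}, X = Fin n.
Vec3 : ℕ → Set
Vec3 n = Fin n → Fin n → Fin n → Bool

-- A cyclic ordering is represented by any of its linear representatives,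
-- a duplicate-free list L.
_⪰_ : {n : ℕ} → List (Fin n) → List (Fin n) → Set
L ⪰ ys = ∃[ A ] ∃[ B ] (L ≡ A ++ B × ys ⊆ (B ++ A))

uC-one : {n : ℕ} → List (Fin n) → Fin n → Fin n → Fin n → Set
uC-one L x y z = x ≢ y × y ≢ z × x ≢ z × L ⪰ (x ∷ y ∷ z ∷ [])

Cyclic : {n : ℕ} → Vec3 n → Set
Cyclic {n} u = ∃[ L ] (Unique L × (∀ (x : Fin n) → x ∈ L) ×
  (∀ x y z → (u x y z ≡ true) ⇔ uC-one L x y z))

CyclicOn : {n : ℕ} → Subset n → Vec3 n → Set
CyclicOn {n} Z u = ∃[ L ] (Unique L × (∀ (x : Fin n) → (x ∈ L) ⇔ (x S.∈ Z)) ×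
  (∀ x y z → x S.∈ Z → y S.∈ Z → z S.∈ Z → (u x y z ≡ true) ⇔ uC-one L x y z))

record InU {n : ℕ} (u : Vec3 n) : Set where
  field
    diag  : ∀ x y → u x x y ≡ false
    rot   : ∀ x y z → (u x y z xor u y z x) ≡ false
    swap  : ∀ x y z → x ≢ y → y ≢ z → x ≢ z → (u x y z xor u y x z) ≡ true
    four  : ∀ t x y z → t ≢ x → t ≢ y → t ≢ z → x ≢ y → x ≢ z → y ≢ z →
            (u t x y xor u t x z xor u t y z xor u x y z) ≡ false

module Submission where

-- Forward: filtering a linear representative of a cyclic ordering of X to
-- Z represents its restriction.  Backward: fix the base point 0 and order
-- X by  a ≺ b  iff  u(0,a,b) = 1, with 0 first.  The four-term relation
-- with t = 0 writes u(x,y,z) as [x≺y] + [x≺z] + [y≺z], and this is 1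
-- exactly when x, y, z occur cyclically in a ≺-sorted enumeration of X,
-- provided ≺ is transitive.  Transitivity of ≺ is where the 4-element
-- subsets enter: u(0,a,h) = u(0,h,b) = 1 puts 0,a,h and 0,h,b in cyclic
-- order in a cyclic ordering of {0,a,h,b}, hence also 0,a,b.

open import Defs
open import Level using (Level)
open import Data.Bool using (Bool; true; false; not; _xor_)
open import Data.Bool.Properties
  using (xor-assoc; xor-comm; xor-identityʳ; true-xor; not-involutive)
open import Data.Empty using (⊥-elim)
open import Data.Fin using (Fin; zero; suc; _≟_)
open import Data.Fin.Subset using (Subset; ∣_∣; ⁅_⁆; _∪_; _∉_; outside; inside) renaming (⊥ to ∅)
import Data.Fin.Subset as S
open import Data.Fin.Subset.Properties
  using (_∈?_; x∈⁅x⁆; x∈⁅y⁆⇒x≡y; x∈p∪q⁻; x∈p∪q⁺; ∪-identityˡ; ∉⊥; ∣⊥∣≡0)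
open import Data.List using (List; []; _∷_; _++_; filter; foldr; length; allFin)
open import Data.List.Properties using (filter-all; filter-++)
open import Data.List.Membership.Propositional using (_∈_)
open import Data.List.Membership.Propositional.Properties using (∈-allFin; ∈-filter⁻; ∈-filter⁺)
open import Data.List.Relation.Unary.All as All using (All; []; _∷_)
open import Data.List.Relation.Unary.Any as Any using (here; there)
open import Data.List.Relation.Unary.Any.Properties using (++-comm)
open import Data.List.Relation.Unary.AllPairs as AllPairs using (AllPairs; []; _∷_)
open import Data.List.Relation.Unary.Unique.Propositional using (Unique)
import Data.List.Relation.Unary.Unique.Propositional.Properties as Unique
open import Data.List.Relation.Unary.Sorted.TotalOrder.Properties using (Sorted⇒AllPairs)
open import Data.List.Relation.Binary.Sublist.Propositional
  using (_⊆_; []; _∷_; _∷ʳ_; minimum; lookup; ⊆-trans)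
open import Data.List.Relation.Binary.Sublist.Propositional.Properties
  using (++⁺; filter-⊆; filter⁺; All-resp-⊆)
open import Data.List.Relation.Binary.Permutation.Propositional using (↭-sym; ↭⇒↭ₛ)
open import Data.List.Relation.Binary.Permutation.Propositional.Properties using (∈-resp-↭)
import Data.List.Relation.Binary.Permutation.Setoid.Properties as SetoidPermutation
import Data.List.Sort as Sort
open import Data.Nat using (ℕ; zero; suc; _<_; s≤s; z≤n)
open import Data.Nat.Properties using (<-trans; <-asym)
open import Data.Product using (_×_; _,_; ∃₂; ∃-syntax; proj₁; proj₂; map₂)
open import Data.Sum using (_⊎_; inj₁; inj₂; [_,_]′)
open import Data.Vec.Base using (_∷_) renaming (here to vhere; there to vthere)
open import Function using (id; _∘_)
open import Function.Bundles using (_⇔_; mk⇔; Equivalence)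
open import Relation.Binary.Bundles using (DecTotalOrder)
open import Relation.Binary.Definitions
  using (Asymmetric; Transitive; Trichotomous; tri<; tri≈; tri>)
open import Relation.Binary.Structures using (IsStrictTotalOrder)
import Relation.Binary.Construct.StrictToNonStrict as StrictToNonStrict
open import Relation.Binary.PropositionalEquality
  using ( _≡_; _≢_; ≢-sym; refl; sym; trans; cong; subst₂; resp₂; isEquivalence; setoid
        ; module ≡-Reasoning)
open import Relation.Nullary using (¬_; yes; no)
open import Relation.Unary using (Pred; Decidable)

private
  variable
    A : Set
    ℓ : Level
    n : ℕ

xor≡false⇒≡ : ∀ {a b} → a xor b ≡ false → a ≡ b
xor≡false⇒≡ {false} {false} _ = refl
xor≡false⇒≡ {true} {true} _ = refl

xor≡true⇒≡not : ∀ {a b} → a xor b ≡ true → b ≡ not a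
xor≡true⇒≡not {false} {true} _ = refl
xor≡true⇒≡not {true} {false} _ = refl

-- xy, yz, xz are the truth values of x ≺ y, y ≺ z, x ≺ z for a strict total
-- order ≺ on distinct x, y, z, so that z ≺ x is not xz.
xor≡true⇔cyclic : ∀ xy yz xz →
  (xy ≡ true → yz ≡ true → xz ≡ true) → (not yz ≡ true → not xy ≡ true → not xz ≡ true) →
  (xy xor xz xor yz) ≡ true ⇔
    ((xy ≡ true × yz ≡ true) ⊎ (yz ≡ true × not xz ≡ true) ⊎ (not xz ≡ true × xy ≡ true))
xor≡true⇔cyclic true true true _ _ = mk⇔ (λ _ → inj₁ (refl , refl)) (λ _ → refl)
xor≡true⇔cyclic true true false trans₁ _ with () ← trans₁ refl refl
xor≡true⇔cyclic true false true _ _ =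
  mk⇔ (λ ()) λ { (inj₁ (_ , ())) ; (inj₂ (inj₁ (() , _))) ; (inj₂ (inj₂ (() , _))) }
xor≡true⇔cyclic true false false _ _ = mk⇔ (λ _ → inj₂ (inj₂ (refl , refl))) (λ _ → refl)
xor≡true⇔cyclic false true true _ _ =
  mk⇔ (λ ()) λ { (inj₁ (() , _)) ; (inj₂ (inj₁ (_ , ()))) ; (inj₂ (inj₂ (() , _))) }
xor≡true⇔cyclic false true false _ _ = mk⇔ (λ _ → inj₂ (inj₁ (refl , refl))) (λ _ → refl)
xor≡true⇔cyclic false false true _ trans₂ with () ← trans₂ refl refl
xor≡true⇔cyclic false false false _ _ =
  mk⇔ (λ ()) λ { (inj₁ (() , _)) ; (inj₂ (inj₁ (() , _))) ; (inj₂ (inj₂ (_ , ()))) }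

⊆-++-split : ∀ {xs} ys {zs : List A} → xs ⊆ ys ++ zs →
  ∃₂ λ xs₁ xs₂ → xs ≡ xs₁ ++ xs₂ × xs₁ ⊆ ys × xs₂ ⊆ zs
⊆-++-split [] s = [] , _ , refl , [] , s
⊆-++-split (y ∷ ys) (.y ∷ʳ s) with ⊆-++-split ys s
... | xs₁ , xs₂ , refl , s₁ , s₂ = xs₁ , xs₂ , refl , y ∷ʳ s₁ , s₂
⊆-++-split (y ∷ ys) (refl ∷ s) with ⊆-++-split ys s
... | xs₁ , xs₂ , refl , s₁ , s₂ = y ∷ xs₁ , xs₂ , refl , refl ∷ s₁ , s₂

++-⊆-split : ∀ (xs : List A) {ys zs} → xs ++ ys ⊆ zs →
  ∃₂ λ zs₁ zs₂ → zs ≡ zs₁ ++ zs₂ × xs ⊆ zs₁ × ys ⊆ zs₂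
++-⊆-split [] s = [] , _ , refl , minimum _ , s
++-⊆-split (x ∷ xs) (z ∷ʳ s) with ++-⊆-split (x ∷ xs) s
... | zs₁ , zs₂ , refl , s₁ , s₂ = z ∷ zs₁ , zs₂ , refl , z ∷ʳ s₁ , s₂
++-⊆-split (x ∷ xs) (refl ∷ s) with ++-⊆-split xs s
... | zs₁ , zs₂ , refl , s₁ , s₂ = x ∷ zs₁ , zs₂ , refl , refl ∷ s₁ , s₂

module _ {R : A → A → Set} where

  AllPairs-resp-⊇ : {xs ys : List A} → xs ⊆ ys → AllPairs R ys → AllPairs R xs
  AllPairs-resp-⊇ [] [] = []
  AllPairs-resp-⊇ (_ ∷ʳ s) (_ ∷ Rys) = AllPairs-resp-⊇ s Rys
  AllPairs-resp-⊇ (refl ∷ s) (Ry ∷ Rys) = All-resp-⊆ s Ry ∷ AllPairs-resp-⊇ s Rys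

  AllPairs⇒⊆ : Asymmetric R → {xs L : List A} →
    AllPairs R L → AllPairs R xs → All (_∈ L) xs → xs ⊆ L
  AllPairs⇒⊆ asym RL [] [] = minimum _
  AllPairs⇒⊆ asym (Ry ∷ RL) (Rx ∷ Rxs) (here refl ∷ xs∈) =
    refl ∷ AllPairs⇒⊆ asym RL Rxs
      (All.zipWith (λ (Rxw , w∈) → Any.tail (λ { refl → asym Rxw Rxw }) w∈) (Rx , xs∈))
  AllPairs⇒⊆ asym (Ry ∷ RL) Rxxs@(Rx ∷ _) (there x∈L ∷ xs∈) =
    _ ∷ʳ AllPairs⇒⊆ asym RL Rxxs (x∈L ∷
      All.zipWith (λ (Rxw , w∈) → Any.tail (λ { refl → asym Rxw (All.lookup Ry x∈L) }) w∈)
                  (Rx , xs∈))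

⪰⇔rotation⊆ : {L zs : List (Fin n)} →
  L ⪰ zs ⇔ ∃₂ λ xs ys → zs ≡ ys ++ xs × xs ++ ys ⊆ L
⪰⇔rotation⊆ = mk⇔ to from
  where
  to : ∀ {L zs} → L ⪰ zs → ∃₂ λ xs ys → zs ≡ ys ++ xs × xs ++ ys ⊆ L
  to (L₁ , L₂ , refl , s) with ⊆-++-split L₂ s
  ... | zs₁ , zs₂ , refl , s₁ , s₂ = zs₂ , zs₁ , refl , ++⁺ s₂ s₁
  from : ∀ {L zs} → (∃₂ λ xs ys → zs ≡ ys ++ xs × xs ++ ys ⊆ L) → L ⪰ zs
  from (xs , ys , refl , s) with ++-⊆-split xs s
  ... | L₁ , L₂ , refl , s₁ , s₂ = L₁ , L₂ , refl , ++⁺ s₂ s₁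

⪰-resp-⊆ : {M L zs : List (Fin n)} → M ⊆ L → M ⪰ zs → L ⪰ zs
⪰-resp-⊆ M⊆L M⪰zs with Equivalence.to ⪰⇔rotation⊆ M⪰zs
... | xs , ys , eq , s = Equivalence.from ⪰⇔rotation⊆ (xs , ys , eq , ⊆-trans s M⊆L)

⪰-filter⁺ : {P : Pred (Fin n) ℓ} (P? : Decidable P) {L zs : List (Fin n)} →
  All P zs → L ⪰ zs → filter P? L ⪰ zs
⪰-filter⁺ P? Pzs (L₁ , L₂ , refl , s) = filter P? L₁ , filter P? L₂ , filter-++ P? L₁ L₂ ,
  subst₂ _⊆_ (filter-all P? Pzs) (filter-++ P? L₂ L₁) (filter⁺ P? P? (λ { refl Px → Px }) s)

⪰⇒∈ : {L zs : List (Fin n)} {x : Fin n} → L ⪰ zs → x ∈ zs → x ∈ L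
⪰⇒∈ (L₁ , L₂ , refl , s) x∈zs = ++-comm L₂ L₁ (lookup s x∈zs)

uC-one⇒⪰ : ∀ {L : List (Fin n)} {x y z} → uC-one L x y z → L ⪰ (x ∷ y ∷ z ∷ [])
uC-one⇒⪰ (_ , _ , _ , L⪰xyz) = L⪰xyz

uC-one-map : ∀ {L M : List (Fin n)} {x y z} →
  (L ⪰ (x ∷ y ∷ z ∷ []) → M ⪰ (x ∷ y ∷ z ∷ [])) → uC-one L x y z → uC-one M x y z
uC-one-map f = map₂ (map₂ (map₂ f))

CyclicTriple : (A → A → Set) → A → A → A → Set
CyclicTriple R x y z = (R x y × R y z) ⊎ (R y z × R z x) ⊎ (R z x × R x y)

module _ {R : A → A → Set} (R-trans : Transitive R) (asym : Asymmetric R) where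

  CyclicTriple-trans : ∀ {t a h b} →
    CyclicTriple R t a h → CyclicTriple R t h b → CyclicTriple R t a b
  CyclicTriple-trans (inj₁ (Rta , Rah)) (inj₁ (Rth , Rhb)) = inj₁ (Rta , R-trans Rah Rhb)
  CyclicTriple-trans (inj₁ (Rta , Rah)) (inj₂ (inj₁ (Rhb , Rbt))) =
    ⊥-elim (asym (R-trans Rta Rah) (R-trans Rhb Rbt))
  CyclicTriple-trans (inj₁ (Rta , Rah)) (inj₂ (inj₂ (Rbt , Rth))) = inj₂ (inj₂ (Rbt , Rta))
  CyclicTriple-trans (inj₂ (inj₁ (Rah , Rht))) (inj₂ (inj₁ (Rhb , Rbt))) =
    inj₂ (inj₁ (R-trans Rah Rhb , Rbt))
  CyclicTriple-trans (inj₂ (inj₂ (Rht , Rta))) (inj₂ (inj₁ (Rhb , Rbt))) = inj₂ (inj₂ (Rbt , Rta))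
  CyclicTriple-trans (inj₂ (inj₁ (Rah , Rht))) (inj₁ (Rth , Rhb)) = ⊥-elim (asym Rht Rth)
  CyclicTriple-trans (inj₂ (inj₁ (Rah , Rht))) (inj₂ (inj₂ (Rbt , Rth))) = ⊥-elim (asym Rht Rth)
  CyclicTriple-trans (inj₂ (inj₂ (Rht , Rta))) (inj₁ (Rth , Rhb)) = ⊥-elim (asym Rht Rth)
  CyclicTriple-trans (inj₂ (inj₂ (Rht , Rta))) (inj₂ (inj₂ (Rbt , Rth))) = ⊥-elim (asym Rht Rth)

module _ {R : Fin n → Fin n → Set} {L : List (Fin n)} (RL : AllPairs R L) where

  ⊆-triple⇒ordered : ∀ {a b c} → a ∷ b ∷ c ∷ [] ⊆ L → R a b × R b c
  ⊆-triple⇒ordered s with AllPairs-resp-⊇ s RL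
  ... | (Rab ∷ _) ∷ (Rbc ∷ []) ∷ [] ∷ [] = Rab , Rbc

  ⪰⇒CyclicTriple : ∀ {x y z} → L ⪰ (x ∷ y ∷ z ∷ []) → CyclicTriple R x y z
  ⪰⇒CyclicTriple L⪰xyz with Equivalence.to ⪰⇔rotation⊆ L⪰xyz
  ... | _ , [] , refl , s = inj₁ (⊆-triple⇒ordered s)
  ... | _ , _ ∷ [] , refl , s = inj₂ (inj₁ (⊆-triple⇒ordered s))
  ... | _ , _ ∷ _ ∷ [] , refl , s = inj₂ (inj₂ (⊆-triple⇒ordered s))
  ... | [] , _ ∷ _ ∷ _ ∷ [] , refl , s = inj₁ (⊆-triple⇒ordered s)

position : Fin n → List (Fin n) → ℕ
position x [] = 0
position x (y ∷ ys) with x ≟ y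
... | yes _ = 0
... | no _ = suc (position x ys)

module _ {h : Fin n} {t : List (Fin n)} where

  position-head : position h (h ∷ t) ≡ 0
  position-head with h ≟ h
  ... | yes _ = refl
  ... | no h≢h = ⊥-elim (h≢h refl)

  position-there : ∀ {x} → h ≢ x → position x (h ∷ t) ≡ suc (position x t)
  position-there {x} h≢x with x ≟ h
  ... | yes refl = ⊥-elim (h≢x refl)
  ... | no _ = refl

Unique⇒position-sorted : {L : List (Fin n)} → Unique L →
  AllPairs (λ a b → position a L < position b L) L
Unique⇒position-sorted [] = []
Unique⇒position-sorted {L = h ∷ t} (h∉t ∷ ut) =
  All.map head<there h∉t ∷ shift h∉t (Unique⇒position-sorted ut)
  where
  head<there : ∀ {b} → h ≢ b → position h (h ∷ t) < position b (h ∷ t)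
  head<there h≢b rewrite position-head {h = h} {t = t} | position-there {t = t} h≢b = s≤s z≤n
  there<there : ∀ {a b} → h ≢ a → h ≢ b → position a t < position b t →
    position a (h ∷ t) < position b (h ∷ t)
  there<there h≢a h≢b a<b rewrite position-there {t = t} h≢a | position-there {t = t} h≢b = s≤s a<b
  shift : ∀ {xs} → All (h ≢_) xs → AllPairs (λ a b → position a t < position b t) xs →
    AllPairs (λ a b → position a (h ∷ t) < position b (h ∷ t)) xs
  shift [] [] = []
  shift (h≢a ∷ h∉xs) (a<xs ∷ sorted) =
    All.zipWith (λ (h≢b , a<b) → there<there h≢a h≢b a<b) (h∉xs , a<xs) ∷ shift h∉xs sorted

module _ {R : Fin n → Fin n → Set} (R-trans : Transitive R) (asym : Asymmetric R)
         {L : List (Fin n)} (RL : AllPairs R L) where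

  ordered⇒⊆-triple : ∀ {a b c} → a ∈ L → b ∈ L → c ∈ L → R a b → R b c → a ∷ b ∷ c ∷ [] ⊆ L
  ordered⇒⊆-triple a∈ b∈ c∈ Rab Rbc = AllPairs⇒⊆ asym RL
    ((Rab ∷ R-trans Rab Rbc ∷ []) ∷ (Rbc ∷ []) ∷ [] ∷ []) (a∈ ∷ b∈ ∷ c∈ ∷ [])

  CyclicTriple⇒⪰ : ∀ {x y z} → x ∈ L → y ∈ L → z ∈ L →
    CyclicTriple R x y z → L ⪰ (x ∷ y ∷ z ∷ [])
  CyclicTriple⇒⪰ x∈L y∈L z∈L (inj₁ (Rxy , Ryz)) =
    Equivalence.from ⪰⇔rotation⊆ (_ , [] , refl , ordered⇒⊆-triple x∈L y∈L z∈L Rxy Ryz)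
  CyclicTriple⇒⪰ x∈L y∈L z∈L (inj₂ (inj₁ (Ryz , Rzx))) =
    Equivalence.from ⪰⇔rotation⊆ (_ , _ ∷ [] , refl , ordered⇒⊆-triple y∈L z∈L x∈L Ryz Rzx)
  CyclicTriple⇒⪰ x∈L y∈L z∈L (inj₂ (inj₂ (Rzx , Rxy))) =
    Equivalence.from ⪰⇔rotation⊆ (_ , _ ∷ _ ∷ [] , refl , ordered⇒⊆-triple z∈L x∈L y∈L Rzx Rxy)

⪰-trans : {L : List (Fin n)} → Unique L → ∀ {t a h b} →
  L ⪰ (t ∷ a ∷ h ∷ []) → L ⪰ (t ∷ h ∷ b ∷ []) → L ⪰ (t ∷ a ∷ b ∷ [])
⪰-trans {L = L} uL tah thb =
  CyclicTriple⇒⪰ {R = _≺_} <-trans <-asym sorted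
    (⪰⇒∈ tah (here refl)) (⪰⇒∈ tah (there (here refl))) (⪰⇒∈ thb (there (there (here refl))))
    (CyclicTriple-trans {R = _≺_} <-trans <-asym
      (⪰⇒CyclicTriple sorted tah) (⪰⇒CyclicTriple sorted thb))
  where
  _≺_ : Fin _ → Fin _ → Set
  a ≺ b = position a L < position b L
  sorted : AllPairs _≺_ L
  sorted = Unique⇒position-sorted uL

∣⁅x⁆∪p∣ : ∀ (x : Fin n) p → x ∉ p → ∣ ⁅ x ⁆ ∪ p ∣ ≡ suc ∣ p ∣
∣⁅x⁆∪p∣ zero (inside ∷ p) x∉p = ⊥-elim (x∉p vhere)
∣⁅x⁆∪p∣ zero (outside ∷ p) _ = cong (suc ∘ ∣_∣) (∪-identityˡ p)
∣⁅x⁆∪p∣ (suc x) (inside ∷ p) x∉p = cong suc (∣⁅x⁆∪p∣ x p (x∉p ∘ vthere))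
∣⁅x⁆∪p∣ (suc x) (outside ∷ p) x∉p = ∣⁅x⁆∪p∣ x p (x∉p ∘ vthere)

fromList : List (Fin n) → Subset n
fromList = foldr (λ x p → ⁅ x ⁆ ∪ p) ∅

∈-fromList⁺ : ∀ {x} {xs : List (Fin n)} → x ∈ xs → x S.∈ fromList xs
∈-fromList⁺ {x = x} (here refl) = x∈p∪q⁺ (inj₁ (x∈⁅x⁆ x))
∈-fromList⁺ (there x∈xs) = x∈p∪q⁺ (inj₂ (∈-fromList⁺ x∈xs))

∈-fromList⁻ : ∀ {x} (xs : List (Fin n)) → x S.∈ fromList xs → x ∈ xs
∈-fromList⁻ [] x∈ = ⊥-elim (∉⊥ x∈)
∈-fromList⁻ (y ∷ xs) x∈ =
  [ here ∘ x∈⁅y⁆⇒x≡y y , there ∘ ∈-fromList⁻ xs ]′ (x∈p∪q⁻ ⁅ y ⁆ (fromList xs) x∈)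

∣fromList∣ : {xs : List (Fin n)} → Unique xs → ∣ fromList xs ∣ ≡ length xs
∣fromList∣ {n = n} [] = ∣⊥∣≡0 n
∣fromList∣ {xs = x ∷ xs} (x∉xs ∷ u) =
  trans (∣⁅x⁆∪p∣ x (fromList xs) (λ x∈ → All.lookup x∉xs (∈-fromList⁻ xs x∈) refl))
        (cong suc (∣fromList∣ u))

sorted-enumeration : {_<_ : Fin n → Fin n → Set ℓ} → IsStrictTotalOrder _≡_ _<_ →
  ∃[ L ] Unique L × (∀ x → x ∈ L) × AllPairs _<_ L
sorted-enumeration {n = n} {_<_ = _<_} isSTO = L , unique , complete , sorted
  where
  order : DecTotalOrder _ _ _
  order = record { isDecTotalOrder = StrictToNonStrict.isDecTotalOrder _≡_ _<_ isSTO }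
  open Sort order using (sort; sort-↭; sort-↗)
  L : List (Fin n)
  L = sort (allFin n)
  unique : Unique L
  unique = SetoidPermutation.Unique-resp-↭ (setoid (Fin n))
    (↭⇒↭ₛ (↭-sym (sort-↭ (allFin n)))) (Unique.allFin⁺ n)
  complete : ∀ x → x ∈ L
  complete x = ∈-resp-↭ (↭-sym (sort-↭ (allFin n))) (∈-allFin x)
  sorted : AllPairs _<_ L
  sorted = AllPairs.zipWith (λ (x≤y , x≢y) → [ id , ⊥-elim ∘ x≢y ]′ x≤y)
    (Sorted⇒AllPairs (DecTotalOrder.totalOrder order) (sort-↗ (allFin n)) , unique)

StrictTotalOrder⇒Cyclic : {u : Vec3 n} {R : Fin n → Fin n → Set} → IsStrictTotalOrder _≡_ R →
  (∀ {x y z} → u x y z ≡ true → x ≢ y × y ≢ z × x ≢ z) →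
  (∀ {x y z} → x ≢ y → y ≢ z → x ≢ z → u x y z ≡ true ⇔ CyclicTriple R x y z) →
  Cyclic u
StrictTotalOrder⇒Cyclic {u = u} {R} isSTO distinct u⇔R with sorted-enumeration isSTO
... | L , uL , complete , sorted = L , uL , complete , λ x y z → mk⇔ to from
  where
  open IsStrictTotalOrder isSTO using (asym) renaming (trans to R-trans)
  to : ∀ {x y z} → u x y z ≡ true → uC-one L x y z
  to {x} {y} {z} uxyz with distinct uxyz
  ... | x≢y , y≢z , x≢z = x≢y , y≢z , x≢z ,
    CyclicTriple⇒⪰ R-trans asym sorted (complete x) (complete y) (complete z)
      (Equivalence.to (u⇔R x≢y y≢z x≢z) uxyz)
  from : ∀ {x y z} → uC-one L x y z → u x y z ≡ true
  from (x≢y , y≢z , x≢z , L⪰xyz) = Equivalence.from (u⇔R x≢y y≢z x≢z) (⪰⇒CyclicTriple sorted L⪰xyz)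

module _ {u : Vec3 n} (U : InU u) where
  open InU U

  u-rotate : ∀ x y z → u x y z ≡ u y z x
  u-rotate x y z = xor≡false⇒≡ (rot x y z)

  u-swap : ∀ {x y z} → x ≢ y → y ≢ z → x ≢ z → u y x z ≡ not (u x y z)
  u-swap x≢y y≢z x≢z = xor≡true⇒≡not (swap _ _ _ x≢y y≢z x≢z)

  u-antisym : ∀ {t a b} → t ≢ a → t ≢ b → a ≢ b → u t b a ≡ not (u t a b)
  u-antisym {t} {a} {b} t≢a t≢b a≢b = begin
    u t b a        ≡⟨ u-rotate t b a ⟩
    u b a t        ≡⟨ u-swap a≢b (≢-sym t≢b) (≢-sym t≢a) ⟩
    not (u a b t)  ≡⟨ cong not (sym (u-rotate t a b)) ⟩
    not (u t a b)  ∎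
    where open ≡-Reasoning

  u-four : ∀ {t x y z} → t ≢ x → t ≢ y → t ≢ z → x ≢ y → x ≢ z → y ≢ z →
    u x y z ≡ u t x y xor u t x z xor u t y z
  u-four {t} {x} {y} {z} t≢x t≢y t≢z x≢y x≢z y≢z = sym (xor≡false⇒≡ (begin
    (u t x y xor u t x z xor u t y z) xor u x y z
      ≡⟨ xor-assoc (u t x y) _ _ ⟩
    u t x y xor (u t x z xor u t y z) xor u x y z
      ≡⟨ cong (u t x y xor_) (xor-assoc (u t x z) _ _) ⟩
    u t x y xor u t x z xor u t y z xor u x y z
      ≡⟨ four t x y z t≢x t≢y t≢z x≢y x≢z y≢z ⟩
    false
      ∎))
    where open ≡-Reasoning

  u-true⇒distinct : ∀ {x y z} → u x y z ≡ true → x ≢ y × y ≢ z × x ≢ z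
  u-true⇒distinct {x} {y} {z} uxyz = x≢y , y≢z , x≢z
    where
    x≢y : x ≢ y
    x≢y refl with () ← trans (sym uxyz) (diag x z)
    y≢z : y ≢ z
    y≢z refl with () ← trans (sym uxyz) (trans (u-rotate x y y) (diag y x))
    x≢z : x ≢ z
    x≢z refl with () ← trans (sym uxyz) (trans (u-rotate x y x) (trans (u-rotate y x x) (diag x y)))

CyclicOn⇒u-trans : {u : Vec3 n} {Z : Subset n} → CyclicOn Z u → ∀ {t a h b} →
  t S.∈ Z → a S.∈ Z → h S.∈ Z → b S.∈ Z → t ≢ a → a ≢ b → t ≢ b →
  u t a h ≡ true → u t h b ≡ true → u t a b ≡ true
CyclicOn⇒u-trans (L , uL , _ , tri) {t} {a} {h} {b} t∈ a∈ h∈ b∈ t≢a a≢b t≢b utah uthb =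
  Equivalence.from (tri t a b t∈ a∈ b∈) (t≢a , a≢b , t≢b ,
    ⪰-trans uL (uC-one⇒⪰ (Equivalence.to (tri t a h t∈ a∈ h∈) utah))
               (uC-one⇒⪰ (Equivalence.to (tri t h b t∈ h∈ b∈) uthb)))

u-trans : {u : Vec3 n} → InU u → (∀ (Z : Subset n) → ∣ Z ∣ ≡ 4 → CyclicOn Z u) →
  ∀ {t a h b} → t ≢ a → t ≢ h → t ≢ b → u t a h ≡ true → u t h b ≡ true → u t a b ≡ true
u-trans {n = n} U cyclic₄ {t} {a} {h} {b} t≢a t≢h t≢b utah uthb =
  CyclicOn⇒u-trans (cyclic₄ (fromList quadruple) (∣fromList∣ distinct))
    (member (here refl)) (member (there (here refl)))
    (member (there (there (here refl)))) (member (there (there (there (here refl)))))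
    t≢a a≢b t≢b utah uthb
  where
  a≢h : a ≢ h
  a≢h = proj₁ (proj₂ (u-true⇒distinct U utah))
  h≢b : h ≢ b
  h≢b = proj₁ (proj₂ (u-true⇒distinct U uthb))
  a≢b : a ≢ b
  a≢b refl with () ← trans (sym uthb) (trans (u-antisym U t≢a t≢h a≢h) (cong not utah))
  quadruple : List (Fin n)
  quadruple = t ∷ a ∷ h ∷ b ∷ []
  distinct : Unique quadruple
  distinct = (t≢a ∷ t≢h ∷ t≢b ∷ []) ∷ (a≢h ∷ a≢b ∷ []) ∷ (h≢b ∷ []) ∷ [] ∷ []
  member : ∀ {x} → x ∈ quadruple → x S.∈ fromList quadruple
  member = ∈-fromList⁺

module BasePoint {m : ℕ} {u : Vec3 (suc m)} (U : InU u)
  (cyclic₄ : ∀ (Z : Subset (suc m)) → ∣ Z ∣ ≡ 4 → CyclicOn Z u) where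

  open InU U

  X : Set
  X = Fin (suc m)

  _≺ᵇ_ : X → X → Bool
  zero ≺ᵇ zero = false
  zero ≺ᵇ suc _ = true
  suc _ ≺ᵇ zero = false
  suc a ≺ᵇ suc b = u zero (suc a) (suc b)

  _≺_ : X → X → Set
  a ≺ b = a ≺ᵇ b ≡ true

  ≺ᵇ-irrefl : ∀ a → a ≺ᵇ a ≡ false
  ≺ᵇ-irrefl zero = refl
  ≺ᵇ-irrefl (suc a) = trans (u-rotate U zero (suc a) (suc a)) (diag (suc a) zero)

  ≺ᵇ-flip : ∀ {a b} → a ≢ b → b ≺ᵇ a ≡ not (a ≺ᵇ b)
  ≺ᵇ-flip {zero} {zero} a≢b = ⊥-elim (a≢b refl)
  ≺ᵇ-flip {zero} {suc b} _ = refl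
  ≺ᵇ-flip {suc a} {zero} _ = refl
  ≺ᵇ-flip {suc a} {suc b} a≢b = u-antisym U (λ ()) (λ ()) a≢b

  ≺-trans : ∀ {a h b} → a ≺ h → h ≺ b → a ≺ b
  ≺-trans {zero} {suc h} {suc b} _ _ = refl
  ≺-trans {suc a} {suc h} {suc b} a≺h h≺b = u-trans U cyclic₄ (λ ()) (λ ()) (λ ()) a≺h h≺b

  ≺-irrefl : ∀ a → ¬ a ≺ a
  ≺-irrefl a a≺a with () ← trans (sym a≺a) (≺ᵇ-irrefl a)

  ≺-asym : ∀ a b → a ≺ b → ¬ b ≺ a
  ≺-asym a b a≺b b≺a with a ≟ b
  ... | yes refl = ≺-irrefl a a≺b
  ... | no a≢b with () ← trans (sym b≺a) (trans (≺ᵇ-flip a≢b) (cong not a≺b))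

  ≺-isStrictTotalOrder : IsStrictTotalOrder _≡_ _≺_
  ≺-isStrictTotalOrder = record
    { isStrictPartialOrder = record
      { isEquivalence = isEquivalence
      ; irrefl = λ { {a} refl → ≺-irrefl a }
      ; trans = λ {a h b} → ≺-trans {a} {h} {b}
      ; <-resp-≈ = resp₂ _≺_
      }
    ; compare = compare
    }
    where
    compare : Trichotomous _≡_ _≺_
    compare a b with a ≟ b
    ... | yes refl = tri≈ (≺-irrefl a) refl (≺-irrefl a)
    ... | no a≢b with a ≺ᵇ b in a≺ᵇb
    ...   | true = tri< refl a≢b (≺-asym a b a≺ᵇb)
    ...   | false = tri> (λ ()) a≢b (trans (≺ᵇ-flip a≢b) (cong not a≺ᵇb))

  u≡xor : ∀ {x y z} → x ≢ y → y ≢ z → x ≢ z → u x y z ≡ x ≺ᵇ y xor x ≺ᵇ z xor y ≺ᵇ z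
  u≡xor {zero} {zero} x≢y _ _ = ⊥-elim (x≢y refl)
  u≡xor {zero} {suc y} {zero} _ _ x≢z = ⊥-elim (x≢z refl)
  u≡xor {zero} {suc y} {suc z} _ _ _ = sym (not-involutive _)
  u≡xor {suc x} {zero} {zero} _ y≢z _ = ⊥-elim (y≢z refl)
  u≡xor {suc x} {zero} {suc z} _ _ x≢z =
    trans (u-swap U (λ ()) x≢z (λ ())) (trans (sym (true-xor _)) (xor-comm true _))
  u≡xor {suc x} {suc y} {zero} _ _ _ =
    trans (u-rotate U (suc x) (suc y) zero)
      (trans (u-rotate U (suc y) zero (suc x)) (sym (xor-identityʳ _)))
  u≡xor {suc x} {suc y} {suc z} x≢y y≢z x≢z = u-four U (λ ()) (λ ()) (λ ()) x≢y x≢z y≢z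

  u≡true⇔CyclicTriple : ∀ {x y z} → x ≢ y → y ≢ z → x ≢ z →
    u x y z ≡ true ⇔ CyclicTriple _≺_ x y z
  u≡true⇔CyclicTriple {x} {y} {z} x≢y y≢z x≢z =
    subst₂ (λ w v → w ≡ true ⇔ ((x ≺ y × y ≺ z) ⊎ (y ≺ z × v ≡ true) ⊎ (v ≡ true × x ≺ y)))
      (sym (u≡xor x≢y y≢z x≢z)) (sym (≺ᵇ-flip x≢z))
      (xor≡true⇔cyclic (x ≺ᵇ y) (y ≺ᵇ z) (x ≺ᵇ z) (≺-trans {x} {y} {z}) reverse-trans)
    where
    reverse-trans : not (y ≺ᵇ z) ≡ true → not (x ≺ᵇ y) ≡ true → not (x ≺ᵇ z) ≡ true
    reverse-trans z≺y y≺x = trans (sym (≺ᵇ-flip x≢z))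
      (≺-trans {z} {y} {x} (trans (≺ᵇ-flip y≢z) z≺y) (trans (≺ᵇ-flip x≢y) y≺x))

Cyclic⇒CyclicOn : {u : Vec3 n} (Z : Subset n) → Cyclic u → CyclicOn Z u
Cyclic⇒CyclicOn {u = u} Z (L , uL , complete , tri) =
  filter (_∈? Z) L , Unique.filter⁺ (_∈? Z) uL , members , triples
  where
  members : ∀ x → x ∈ filter (_∈? Z) L ⇔ x S.∈ Z
  members x = mk⇔ (proj₂ ∘ ∈-filter⁻ (_∈? Z) {xs = L}) (∈-filter⁺ (_∈? Z) (complete x))
  triples : ∀ x y z → x S.∈ Z → y S.∈ Z → z S.∈ Z →
    u x y z ≡ true ⇔ uC-one (filter (_∈? Z) L) x y z
  triples x y z x∈ y∈ z∈ = mk⇔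
    (uC-one-map (⪰-filter⁺ (_∈? Z) (x∈ ∷ y∈ ∷ z∈ ∷ [])) ∘ Equivalence.to (tri x y z))
    (Equivalence.from (tri x y z) ∘ uC-one-map (⪰-resp-⊆ (filter-⊆ (_∈? Z) L)))

CyclicOn⇒Cyclic : ∀ n {u : Vec3 n} → InU u → (∀ (Z : Subset n) → ∣ Z ∣ ≡ 4 → CyclicOn Z u) →
  Cyclic u
CyclicOn⇒Cyclic zero _ _ = [] , [] , (λ ()) , (λ ())
CyclicOn⇒Cyclic (suc m) U cyclic₄ =
  StrictTotalOrder⇒Cyclic ≺-isStrictTotalOrder (u-true⇒distinct U) u≡true⇔CyclicTriple
  where open BasePoint U cyclic₄

lemma3 : (n : ℕ) (u : Vec3 n) → InU u →
         Cyclic u ⇔ (∀ (Z : Subset n) → ∣ Z ∣ ≡ 4 → CyclicOn Z u)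
lemma3 n u U = mk⇔ (λ cyclic Z _ → Cyclic⇒CyclicOn Z cyclic) (CyclicOn⇒Cyclic n U)
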